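{- Let $q\geq r$ be integers with $r>\frac{2q}{3}$. Then $F_{q,r}(n)=G_{q,r}(n)$ for all positive integers $n$.
   Context: $[n]=\{1,\dots,n\}$. For integers $q\geq r\geq 1$ and $x,y\in\mathbb{R}^q$, write $x<_r y$ if there are at least $r$ coordinates $i\in[q]$ with $x_i<y_i$. $F_{q,r}(n)$ is the maximum $N$ such that there exist vectors $x_1,\dots,x_N\in[n]^q$ with $x_a<_r x_b$ for all $1\leq a<b\leq N$. $G_{q,r}(n)$ is the maximum size of a set $\{x_1,\dots,x_N\}\subseteq[n]^q$ such that for all $a\neq b$, either $x_a<_r x_b$ or $x_b<_r x_a$. -}

module Defs where

open import Data.Nat using (ℕ; _≤_; _<_; _<?_)
open import Data.Fin using (Fin)
open import Data.Fin.Base as Fin using ()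
open import Data.List using (List; length; filter)
open import Data.List.Base using (allFin)
open import Data.Vec using (Vec; lookup)
open import Data.Product using (_×_; Σ)
open import Data.Sum using (_⊎_)
open import Relation.Binary.PropositionalEquality using (_≡_; _≢_)

InBox : (n : ℕ) {q : ℕ} → Vec ℕ q → Set
InBox n {q} x = (i : Fin q) → (1 ≤ lookup x i) × (lookup x i ≤ n)

countLess : {q : ℕ} → Vec ℕ q → Vec ℕ q → ℕ
countLess {q} x y = length (filter (λ i → lookup x i <? lookup y i) (allFin q))

_<[_]_ : {q : ℕ} → Vec ℕ q → ℕ → Vec ℕ q → Set
x <[ r ] y = r ≤ countLess x y

-- N is attained in the definition of F_{q,r}(n): vectors x_1..x_N in [n]^q
-- (indexed by Fin N) with x_a <_r x_b whenever a < b.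
FAchievable : (q r n N : ℕ) → Set
FAchievable q r n N =
  Σ (Fin N → Vec ℕ q) λ x →
    ((a : Fin N) → InBox n (x a)) ×
    ((a b : Fin N) → a Fin.< b → x a <[ r ] x b)

-- N is attained in the definition of G_{q,r}(n): a set of N distinct vectors
-- in [n]^q (an injective family indexed by Fin N), any two distinct elements
-- comparable under <_r in one direction or the other.
GAchievable : (q r n N : ℕ) → Set
GAchievable q r n N =
  Σ (Fin N → Vec ℕ q) λ x →
    ((a : Fin N) → InBox n (x a)) ×
    ((a b : Fin N) → x a ≡ x b → a ≡ b) ×
    ((a b : Fin N) → a ≢ b → (x a <[ r ] x b) ⊎ (x b <[ r ] x a))

-- N is the maximum achievable value (i.e. N = F_{q,r}(n), resp. G_{q,r}(n))
IsF : (q r n N : ℕ) → Set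
IsF q r n N = FAchievable q r n N × ((M : ℕ) → FAchievable q r n M → M ≤ N)

IsG : (q r n N : ℕ) → Set
IsG q r n N = GAchievable q r n N × ((M : ℕ) → GAchievable q r n M → M ≤ N)

-- If x <_r y, y <_r z and z <_r x, then at each coordinate at most two of x_i < y_i, y_i < z_i,
-- z_i < x_i hold, so 3r ≤ 2q. Hence for 3r > 2q the relation <_r has no 3-cycles, and a set of
-- pairwise <_r-comparable vectors is linearly ordered by <_r: insertion sort lists a G-set as an
-- F-sequence. Conversely, <_r is irreflexive, so an F-sequence is a G-set. Thus F and G are
-- achieved by the same sizes; these are bounded by the size of the box and decidable by
-- exhaustive search, so their common maximum exists.
module Submission where

open import Defs
open import Data.Nat using (ℕ; zero; suc; _+_; _*_; _≤_; _<_; z≤n; s≤s; _<?_; _≤?_; _≟_)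
open import Data.Nat.Properties
open import Algebra.Properties.CommutativeSemigroup +-commutativeSemigroup using (x∙yz≈y∙xz)
open import Data.Bool using (true; false)
open import Data.Product using (_×_; _,_; ∃; proj₂)
open import Data.Sum using (_⊎_; inj₁; inj₂; [_,_]′)
open import Data.Empty using (⊥; ⊥-elim)
open import Data.Fin as Fin using (Fin; zero; suc)
import Data.Fin.Properties as Fin
open import Data.Vec as Vec using (Vec; []; _∷_)
open import Data.List as List
  using (List; []; _∷_; [_]; length; filter; tabulate; allFin; upTo; cartesianProductWith)
open import Data.List.Properties using (filter-none; length-tabulate)
open import Data.List.Relation.Unary.All as All using (All; []; _∷_)
import Data.List.Relation.Unary.All.Properties as All
open import Data.List.Relation.Unary.Any as Any using (Any; here)
open import Data.List.Relation.Unary.AllPairs as AllPairs using (AllPairs; []; _∷_)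
import Data.List.Relation.Unary.AllPairs.Properties as AllPairs
open import Data.List.Relation.Binary.Permutation.Propositional
  using (_↭_; ↭-refl; ↭-prep; ↭-swap; ↭-trans; ↭-sym)
open import Data.List.Relation.Binary.Permutation.Propositional.Properties using (All-resp-↭; ↭-length)
open import Data.List.Membership.Propositional using (_∈_)
open import Data.List.Membership.Propositional.Properties
  using (∈-cartesianProductWith⁺; ∈-upTo⁺; ∈-lookup)
import Data.List.Membership.Setoid.Properties as Membership
open import Function using (id; _∘_)
open import Relation.Nullary using (Dec; yes; no; does; contradiction)
open import Relation.Nullary.Decidable using (_×-dec_; map′; decidable-stable)
open import Relation.Unary using (Pred; Empty; _∩_) renaming (Decidable to Decidable₁)
open import Relation.Unary.Properties using (_∩?_)
open import Relation.Binary using (Rel; Decidable; tri<; tri≈; tri>)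
open import Relation.Binary.PropositionalEquality
  using (_≡_; _≢_; refl; sym; trans; cong; subst; subst₂; setoid)

module _ {a p q} {A : Set a} {P : Pred A p} {Q : Pred A q}
         (P? : Decidable₁ P) (Q? : Decidable₁ Q) where

  length-filter-+-≤ : ∀ xs → length (filter P? xs) + length (filter Q? xs) ≤
                             length xs + length (filter (P? ∩? Q?) xs)
  length-filter-+-≤ [] = z≤n
  length-filter-+-≤ (x ∷ xs) with ih ← length-filter-+-≤ xs | does (P? x) | does (Q? x)
  ... | true  | true  = s≤s (subst₂ _≤_ (sym (+-suc _ _)) (sym (+-suc _ _)) (s≤s ih))
  ... | true  | false = s≤s ih
  ... | false | true  = subst₂ _≤_ (sym (+-suc _ _)) refl (s≤s ih)
  ... | false | false = m≤n⇒m≤1+n ih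

module _ {a p q r} {A : Set a} {P : Pred A p} {Q : Pred A q} {R : Pred A r}
         (P? : Decidable₁ P) (Q? : Decidable₁ Q) (R? : Decidable₁ R) where

  length-filter-+-+-≤ : Empty (P ∩ Q ∩ R) → ∀ xs →
    length (filter P? xs) + length (filter Q? xs) + length (filter R? xs) ≤ 2 * length xs
  length-filter-+-+-≤ P∩Q∩R≡∅ xs = begin
    ∣P∣ + ∣Q∣ + ∣R∣    ≡⟨ +-assoc ∣P∣ ∣Q∣ ∣R∣ ⟩
    ∣P∣ + (∣Q∣ + ∣R∣)  ≤⟨ +-monoʳ-≤ ∣P∣ (length-filter-+-≤ Q? R? xs) ⟩
    ∣P∣ + (n + ∣Q∩R∣)  ≡⟨ x∙yz≈y∙xz ∣P∣ n ∣Q∩R∣ ⟩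
    n + (∣P∣ + ∣Q∩R∣)  ≤⟨ +-monoʳ-≤ n (length-filter-+-≤ P? (Q? ∩? R?) xs) ⟩
    n + (n + ∣P∩Q∩R∣)  ≡⟨ cong (λ ys → n + (n + length ys)) P∩Q∩R-filter≡[] ⟩
    2 * n              ∎
    where
    open ≤-Reasoning
    n = length xs
    ∣P∣ = length (filter P? xs)
    ∣Q∣ = length (filter Q? xs)
    ∣R∣ = length (filter R? xs)
    ∣Q∩R∣ = length (filter (Q? ∩? R?) xs)
    ∣P∩Q∩R∣ = length (filter (P? ∩? Q? ∩? R?) xs)
    P∩Q∩R-filter≡[] : filter (P? ∩? Q? ∩? R?) xs ≡ []
    P∩Q∩R-filter≡[] = filter-none (P? ∩? Q? ∩? R?) (All.universal P∩Q∩R≡∅ xs)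

countLess-irrefl : ∀ {q} (x : Vec ℕ q) → countLess x x ≡ 0
countLess-irrefl {q} x = cong length (filter-none (λ i → Vec.lookup x i <? Vec.lookup x i)
                                                  (All.universal (λ _ → <-irrefl refl) (allFin q)))

<[]⇒≢ : ∀ {q r} {x y : Vec ℕ q} → 1 ≤ r → x <[ r ] y → x ≢ y
<[]⇒≢ {x = x} 1≤r x<x refl =
  <-irrefl refl (≤-trans 1≤r (≤-trans x<x (≤-reflexive (countLess-irrefl x))))

countLess-cycle-≤ : ∀ {q} (x y z : Vec ℕ q) →
                    countLess x y + countLess y z + countLess z x ≤ 2 * q
countLess-cycle-≤ {q} x y z =
  subst (λ n → countLess x y + countLess y z + countLess z x ≤ 2 * n) (length-tabulate {n = q} id)
    (length-filter-+-+-≤ (x ≺? y) (y ≺? z) (z ≺? x) no-cycle (allFin q))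
  where
  infix 8 _≺_
  _≺_ : Vec ℕ q → Vec ℕ q → Pred (Fin q) _
  (u ≺ v) i = Vec.lookup u i < Vec.lookup v i
  _≺?_ : ∀ u v → Decidable₁ (u ≺ v)
  (u ≺? v) i = Vec.lookup u i <? Vec.lookup v i
  no-cycle : Empty (x ≺ y ∩ y ≺ z ∩ z ≺ x)
  no-cycle i (x<y , y<z , z<x) = <-asym x<y (<-trans y<z z<x)

<[]-no-3-cycle : ∀ {q r} → 2 * q < 3 * r →
                 (x y z : Vec ℕ q) → x <[ r ] y → y <[ r ] z → z <[ r ] x → ⊥
<[]-no-3-cycle {q} {r} 2q<3r x y z x<y y<z z<x = <⇒≱ 2q<3r (begin
  3 * r                                          ≡⟨ cong (λ k → r + (r + k)) (+-identityʳ r) ⟩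
  r + (r + r)                                    ≡⟨ +-assoc r r r ⟨
  r + r + r                                      ≤⟨ +-mono-≤ (+-mono-≤ x<y y<z) z<x ⟩
  countLess x y + countLess y z + countLess z x  ≤⟨ countLess-cycle-≤ x y z ⟩
  2 * q                                          ∎)
  where open ≤-Reasoning

module InsertionSort {a ℓ} {A : Set a} {R : Rel A ℓ} (R? : Decidable R) where

  insert : A → List A → List A
  insert x [] = [ x ]
  insert x (y ∷ ys) with does (R? x y)
  ... | true  = x ∷ y ∷ ys
  ... | false = y ∷ insert x ys

  sort : List A → List A
  sort []       = []
  sort (x ∷ xs) = insert x (sort xs)

  insert-↭ : ∀ x ys → insert x ys ↭ x ∷ ys
  insert-↭ x [] = ↭-refl
  insert-↭ x (y ∷ ys) with does (R? x y)
  ... | true  = ↭-refl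
  ... | false = ↭-trans (↭-prep y (insert-↭ x ys)) (↭-swap y x ↭-refl)

  sort-↭ : ∀ xs → sort xs ↭ xs
  sort-↭ []       = ↭-refl
  sort-↭ (x ∷ xs) = ↭-trans (insert-↭ x (sort xs)) (↭-prep x (sort-↭ xs))

  Comparable : Rel A ℓ
  Comparable x y = R x y ⊎ R y x

  module _ (no-3-cycle : ∀ x y z → R x y → R y z → R z x → ⊥) where

    insert-sorted : ∀ x ys → All (Comparable x) ys → AllPairs R ys → AllPairs R (insert x ys)
    insert-sorted x [] [] [] = [] ∷ []
    insert-sorted x (y ∷ ys) (x~y ∷ x~ys) (y<ys ∷ ys-sorted) with R? x y
    ... | yes x<y = (x<y ∷ All.zipWith below (y<ys , x~ys)) ∷ y<ys ∷ ys-sorted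
      where
      below : ∀ {z} → R y z × Comparable x z → R x z
      below (_   , inj₁ x<z) = x<z
      below (y<z , inj₂ z<x) = ⊥-elim (no-3-cycle x y _ x<y y<z z<x)
    ... | no x≮y =
      All-resp-↭ (↭-sym (insert-↭ x ys)) (y<x ∷ y<ys) ∷ insert-sorted x ys x~ys ys-sorted
      where
      y<x : R y x
      y<x = [ (λ x<y → contradiction x<y x≮y) , id ]′ x~y

    sort-sorted : ∀ xs → AllPairs Comparable xs → AllPairs R (sort xs)
    sort-sorted []       []                          = []
    sort-sorted (x ∷ xs) (x~xs ∷ xs-comparable) =
      insert-sorted x (sort xs) (All-resp-↭ (↭-sym (sort-↭ xs)) x~xs) (sort-sorted xs xs-comparable)

AllPairs-lookup : ∀ {a ℓ} {A : Set a} {R : Rel A ℓ} {xs : List A} → AllPairs R xs →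
                  ∀ {i j} → i Fin.< j → R (List.lookup xs i) (List.lookup xs j)
AllPairs-lookup {xs = _ ∷ _} (x<xs ∷ _)      {zero}  {suc j} _         = All.lookup x<xs (∈-lookup j)
AllPairs-lookup {xs = _ ∷ _} (_ ∷ xs-sorted) {suc i} {suc j} (s≤s i<j) = AllPairs-lookup xs-sorted i<j

_<[_]?_ : ∀ {q} (x : Vec ℕ q) (r : ℕ) (y : Vec ℕ q) → Dec (x <[ r ] y)
x <[ r ]? y = r ≤? countLess x y

IsChain : ∀ {q} (r n : ℕ) → List (Vec ℕ q) → Set
IsChain r n xs = All (InBox n) xs × AllPairs _<[ r ]_ xs

IsChain⇒FAchievable : ∀ {q r n M} {xs : List (Vec ℕ q)} →
                      length xs ≡ M → IsChain r n xs → FAchievable q r n M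
IsChain⇒FAchievable {xs = xs} refl (inBox , sorted) =
  List.lookup xs , (λ a → All.lookup inBox (∈-lookup a)) , (λ _ _ → AllPairs-lookup sorted)

FAchievable⇒IsChain : ∀ {q r n M} → FAchievable q r n M →
                      ∃ λ (xs : List (Vec ℕ q)) → length xs ≡ M × IsChain r n xs
FAchievable⇒IsChain (x , inBox , chain) =
  tabulate x , length-tabulate x , All.tabulate⁺ inBox , AllPairs.tabulate⁺-< (chain _ _)

FAchievable⇒GAchievable : ∀ {q r n M} → 1 ≤ r → FAchievable q r n M → GAchievable q r n M
FAchievable⇒GAchievable {r = r} 1≤r (x , inBox , chain) = x , inBox , injective , comparable
  where
  comparable : ∀ a b → a ≢ b → (x a <[ r ] x b) ⊎ (x b <[ r ] x a)
  comparable a b a≢b with Fin.<-cmp a b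
  ... | tri< a<b _ _ = inj₁ (chain a b a<b)
  ... | tri≈ _ a≡b _ = contradiction a≡b a≢b
  ... | tri> _ _ b<a = inj₂ (chain b a b<a)
  injective : ∀ a b → x a ≡ x b → a ≡ b
  injective a b xa≡xb = decidable-stable (a Fin.≟ b) λ a≢b →
    [ (λ xa<xb → <[]⇒≢ 1≤r xa<xb xa≡xb) , (λ xb<xa → <[]⇒≢ 1≤r xb<xa (sym xa≡xb)) ]′
      (comparable a b a≢b)

GAchievable⇒FAchievable : ∀ {q r n M} → 2 * q < 3 * r → GAchievable q r n M → FAchievable q r n M
GAchievable⇒FAchievable {q} {r} 2q<3r (x , inBox , _ , comparable) =
  IsChain⇒FAchievable (trans (↭-length (sort-↭ xs)) (length-tabulate x))
    ( All-resp-↭ (↭-sym (sort-↭ xs)) (All.tabulate⁺ inBox)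
    , sort-sorted (<[]-no-3-cycle 2q<3r) xs (AllPairs.tabulate⁺ (comparable _ _)))
  where
  open InsertionSort (λ (u v : Vec ℕ q) → u <[ r ]? v)
  xs = tabulate x

vecsOver : ∀ {a} {A : Set a} (q : ℕ) → List A → List (Vec A q)
vecsOver zero    U = [ [] ]
vecsOver (suc q) U = cartesianProductWith _∷_ U (vecsOver q U)

∈-vecsOver : ∀ {a} {A : Set a} {q} {U : List A} (x : Vec A q) →
             (∀ i → Vec.lookup x i ∈ U) → x ∈ vecsOver q U
∈-vecsOver []       _   = here refl
∈-vecsOver (x ∷ xs) x∈U = ∈-cartesianProductWith⁺ _∷_ (x∈U zero) (∈-vecsOver xs (x∈U ∘ suc))

listsOver : ∀ {a} {A : Set a} → ℕ → List A → List (List A)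
listsOver zero    U = [ [] ]
listsOver (suc M) U = cartesianProductWith _∷_ U (listsOver M U)

∈-listsOver : ∀ {a} {A : Set a} {U xs : List A} → All (_∈ U) xs → xs ∈ listsOver (length xs) U
∈-listsOver []           = here refl
∈-listsOver (x∈U ∷ xs∈U) = ∈-cartesianProductWith⁺ _∷_ x∈U (∈-listsOver xs∈U)

-- Coordinates range over {0,…,n} ⊇ [n]: only an upper bound and a search space are needed.
boxPoints : (n q : ℕ) → List (Vec ℕ q)
boxPoints n q = vecsOver q (upTo (suc n))

InBox⇒∈boxPoints : ∀ {n q} (x : Vec ℕ q) → InBox n x → x ∈ boxPoints n q
InBox⇒∈boxPoints x inBox = ∈-vecsOver x (λ i → ∈-upTo⁺ (s≤s (proj₂ (inBox i))))

GAchievable⇒≤∣boxPoints∣ : ∀ {q r n M} → GAchievable q r n M → M ≤ length (boxPoints n q)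
GAchievable⇒≤∣boxPoints∣ {q} {n = n} (x , inBox , injective , _) =
  Fin.injective⇒≤ (λ {a} {b} same-index →
    injective a b (Membership.index-injective (setoid (Vec ℕ q)) (x∈box a) (x∈box b) same-index))
  where
  x∈box : ∀ a → x a ∈ boxPoints n q
  x∈box a = InBox⇒∈boxPoints (x a) (inBox a)

InBox? : ∀ n {q} (x : Vec ℕ q) → Dec (InBox n x)
InBox? n x = Fin.all? (λ i → (1 ≤? Vec.lookup x i) ×-dec (Vec.lookup x i ≤? n))

FAchievable? : ∀ q r n M → Dec (FAchievable q r n M)
FAchievable? q r n M =
  map′ found⇒FAchievable FAchievable⇒found (Any.any? IsChainOfLength? candidates)
  where
  candidates : List (List (Vec ℕ q))
  candidates = listsOver M (boxPoints n q)
  IsChainOfLength : List (Vec ℕ q) → Set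
  IsChainOfLength xs = length xs ≡ M × IsChain r n xs
  IsChainOfLength? : ∀ xs → Dec (IsChainOfLength xs)
  IsChainOfLength? xs =
    (length xs ≟ M) ×-dec All.all? (InBox? n) xs ×-dec AllPairs.allPairs? _<[ r ]?_ xs
  found⇒FAchievable : Any IsChainOfLength candidates → FAchievable q r n M
  found⇒FAchievable found with _ , length≡M , isChain ← Any.satisfied found =
    IsChain⇒FAchievable length≡M isChain
  FAchievable⇒found : FAchievable q r n M → Any IsChainOfLength candidates
  FAchievable⇒found f with xs , refl , inBox , sorted ← FAchievable⇒IsChain f =
    Any.map (λ { refl → refl , inBox , sorted })
            (∈-listsOver (All.map (λ {x} → InBox⇒∈boxPoints x) inBox))

decidable∧bounded⇒greatest : {P : ℕ → Set} → (∀ M → Dec (P M)) → P 0 →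
                             ∀ k → (∀ M → P M → M ≤ k) →
                             ∃ λ N → P N × (∀ M → P M → M ≤ N)
decidable∧bounded⇒greatest P? p0 k bound with P? k
... | yes pk = k , pk , bound
decidable∧bounded⇒greatest P? p0 zero    bound | no ¬p0 = contradiction p0 ¬p0
decidable∧bounded⇒greatest P? p0 (suc k) bound | no ¬pk =
  decidable∧bounded⇒greatest P? p0 k
    (λ M pM → m<1+n⇒m≤n (≤∧≢⇒< (bound M pM) (λ { refl → ¬pk pM })))

FAchievable-zero : ∀ q r n → FAchievable q r n 0
FAchievable-zero q r n = (λ ()) , (λ ()) , (λ ())

proposition1p3 : (q r : ℕ) → 1 ≤ r → r ≤ q → 2 * q < 3 * r →
                 (n : ℕ) → 1 ≤ n →
                 ∃ λ N → IsF q r n N × IsG q r n N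
proposition1p3 q r 1≤r _ 2q<3r n _ =
  let N , F-N , F-max = decidable∧bounded⇒greatest (FAchievable? q r n) (FAchievable-zero q r n)
                                                   (length (boxPoints n q)) F-bound
  in  N , (F-N , F-max) , (FAchievable⇒GAchievable 1≤r F-N , λ M → F-max M ∘ G⇒F)
  where
  F-bound : ∀ M → FAchievable q r n M → M ≤ length (boxPoints n q)
  F-bound M = GAchievable⇒≤∣boxPoints∣ ∘ FAchievable⇒GAchievable 1≤r
  G⇒F : ∀ {M} → GAchievable q r n M → FAchievable q r n M
  G⇒F = GAchievable⇒FAchievable 2q<3r
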